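{- Let $t$ be an arbor on a set of cardinality $n\ge 2$, let $r$ be the cardinality of the root vertex, and let $t_1,\dots,t_{\mathsf w}$ ($\mathsf w\ge0$) be the sub-trees hanging from the root vertex. Let $W=\prod_kK_{t_k}$ (equal to $1$ if $\mathsf w=0$) and write $W=\sum_{i,j}W_{i,j}X^iY^j$. Then for $0\le j\le k\le n$, the coefficient of $X^jY^k$ in $K_t$ is $$\sum_{\ell=\max(0,\,j-n+r)}^{\min(j,r)}\ \sum_{m=\max(\ell,\,k-n+r)}^{k+\ell-j}\binom{r}{\ell}\binom{m-1}{m-\ell}W_{j-\ell,\,k-m}.$$
   Context: An arbor on a finite non-empty set $I$ is a rooted tree whose vertices are labeled by pairwise disjoint non-empty subsets of $I$ whose union is $I$; we identify a vertex with its label set. For a vertex $v$, $\mathscr{D}(v)$ is the union of the labels of all vertices whose path to the root passes through $v$ (including $v$). The set $P_t$ consists of the points $a\in\mathbb{Z}^I$ with $a_i\ge0$ for all $i$ and $\sum_{i\in\mathscr{D}(v)}a_i\le|\mathscr{D}(v)|$ for every vertex $v$. For $a\in P_t$, $\mathrm{ht}(a)=\sum_ia_i$ and $\mathrm{nz}(a)$ is the number of non-zero coordinates of $a$. Define $K_t(X,Y)=\sum_{a\in P_t}X^{\mathrm{nz}(a)}Y^{\mathrm{ht}(a)}$, and similarly $K_{t_k}$ for each sub-tree $t_k$ (an arbor on the union of its labels). Convention: $\binom{ -1}{0}=1$. -}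

module Defs where

open import Data.Nat using (ℕ; zero; suc; _+_; _*_; _∸_; _≤_; _≤?_; _⊔_; _⊓_)
open import Data.Nat.Properties using (_≟_)
open import Data.Nat.Combinatorics using (_C_)
open import Data.Nat.ListAction using (sum)
open import Data.Empty using (⊥)
open import Data.Unit using (⊤)
open import Data.Fin using (Fin)
open import Data.Fin.Properties using () renaming (_≟_ to _≟ᶠ_)
open import Data.List using (List; []; _∷_; _++_; map; concat; concatMap; length; upTo; filter; foldr; allFin)
open import Data.List.Relation.Unary.All using (All)
open import Data.List.Relation.Unary.All using () renaming (all? to allDec)
open import Data.List.Relation.Unary.Any using (any?)
open import Data.List.Relation.Binary.Permutation.Propositional using (_↭_)
open import Data.List.Membership.Propositional using (_∈_)
open import Data.Vec using (Vec; []; _∷_; lookup; toList)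
open import Data.Product using (_×_; _,_)
open import Data.Sum using (_⊎_)
open import Relation.Nullary using (¬_; Dec; ¬?)
open import Relation.Nullary.Decidable using (_×-dec_; _⊎-dec_)
open import Relation.Binary.PropositionalEquality using (_≡_)

-- Rooted trees whose vertices carry label lists (rose trees).
-- A vertex is identified with the sub-tree rooted at it.

data Tree (A : Set) : Set where
  node : List A → List (Tree A) → Tree A

rootLabel : {A : Set} → Tree A → List A
rootLabel (node L _) = L

children : {A : Set} → Tree A → List (Tree A)
children (node _ cs) = cs

mutual
  vertices : {A : Set} → Tree A → List (Tree A)
  vertices (node L cs) = node L cs ∷ verticesF cs

  verticesF : {A : Set} → List (Tree A) → List (Tree A)
  verticesF []       = []
  verticesF (c ∷ cs) = vertices c ++ verticesF cs

D : {A : Set} → Tree A → List A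
D t = concat (map rootLabel (vertices t))

NonEmpty : {A : Set} → List A → Set
NonEmpty []      = ⊥
NonEmpty (_ ∷ _) = ⊤

-- t is an arbor on I = Fin n: every label non-empty, and the labels are
-- pairwise disjoint (and duplicate-free) with union Fin n, i.e. the
-- concatenation of all labels is a permutation of the list of all of Fin n.
IsArbor : (n : ℕ) → Tree (Fin n) → Set
IsArbor n t = All (λ v → NonEmpty (rootLabel v)) (vertices t) × (D t ↭ allFin n)

-- The lattice-point set P_t and the polynomial K_t.
-- A point a ∈ ℤ^{D(t)} with a ≥ 0 is represented as a : Vec ℕ n (a function
-- Fin n → ℕ) that vanishes outside D(t).

ht : ∀ {n} → Vec ℕ n → ℕ
ht a = sum (toList a)

nz : ∀ {n} → Vec ℕ n → ℕ
nz a = length (filter (λ x → ¬? (x ≟ 0)) (toList a))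

InP : ∀ {n} → Tree (Fin n) → Vec ℕ n → Set
InP {n} t a =
  All (λ i → i ∈ D t ⊎ lookup a i ≡ 0) (allFin n) ×
  All (λ v → sum (map (lookup a) (D v)) ≤ length (D v)) (vertices t)

inP? : ∀ {n} (t : Tree (Fin n)) (a : Vec ℕ n) → Dec (InP t a)
inP? {n} t a =
  allDec (λ i → any? (λ x → i ≟ᶠ x) (D t) ⊎-dec (lookup a i ≟ 0)) (allFin n)
  ×-dec allDec (λ v → sum (map (lookup a) (D v)) ≤? length (D v)) (vertices t)

vecs : (m b : ℕ) → List (Vec ℕ m)
vecs zero    b = [] ∷ []
vecs (suc m) b = concatMap (λ x → map (x ∷_) (vecs m b)) (upTo (suc b))

-- Bivariate polynomials with ℕ coefficients, as coefficient functions: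
-- P i j = coefficient of X^i Y^j.
Poly2 : Set
Poly2 = ℕ → ℕ → ℕ

-- K_t : coefficient of X^i Y^j is #{a ∈ P_t | nz a = i, ht a = j}.
-- (Every a ∈ P_t has all entries ≤ |D(t)| ≤ n, so enumerating entries in
-- {0,…,n} enumerates all of P_t.)
K : ∀ {n} → Tree (Fin n) → Poly2
K {n} t i j =
  length (filter (λ a → inP? t a ×-dec (nz a ≟ i) ×-dec (ht a ≟ j)) (vecs n n))

Σ[_⋯_] : ℕ → ℕ → (ℕ → ℕ) → ℕ
Σ[ lo ⋯ hi ] f = sum (map (λ i → f (lo + i)) (upTo (suc hi ∸ lo)))

one : Poly2
one zero zero = 1
one _    _    = 0

_⊛_ : Poly2 → Poly2 → Poly2
(P ⊛ Q) i j = Σ[ 0 ⋯ i ] λ a → Σ[ 0 ⋯ j ] λ b → P a b * Q (i ∸ a) (j ∸ b)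

W : ∀ {n} → Tree (Fin n) → Poly2
W t = foldr (λ c acc → K c ⊛ acc) one (children t)

-- binom(m - 1, k) with the convention binom(-1, 0) = 1 (for m = 0 only
-- k = 0 occurs in the formula below).
binomPred : ℕ → ℕ → ℕ
binomPred zero    zero    = 1
binomPred zero    (suc _) = 0
binomPred (suc m) k       = m C k

-- right-hand side of the formula; max(0, j-n+r) = (j + r) ∸ n etc.
formula : (n r : ℕ) → Poly2 → ℕ → ℕ → ℕ
formula n r Wc j k =
  Σ[ (j + r) ∸ n ⋯ j ⊓ r ] λ ℓ →
    Σ[ ℓ ⊔ ((k + r) ∸ n) ⋯ (k + ℓ) ∸ j ] λ m →
      (r C ℓ) * binomPred m (m ∸ ℓ) * Wc (j ∸ ℓ) (k ∸ m)

-- Write D(t) = R ⊎ D(t₁) ⊎ ⋯ ⊎ D(t_w) for the root label R. A point a ∈ P_t splits into its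
-- restrictions to these blocks: the part on D(t_k) is exactly a point of P_{t_k} (the constraints of
-- a vertex only involve coordinates below it), the part on R is unconstrained, and the one remaining
-- constraint, ht a ≤ n at the root, holds automatically in degrees k ≤ n. As nz and ht are additive
-- over the blocks, K_t agrees there with the product of W and the generating polynomial of all
-- vectors supported on R, whose coefficient of X^ℓ Y^m is binom(r, ℓ) binom(m - 1, ℓ - 1): choose
-- the ℓ non-zero coordinates, then a composition of m into ℓ positive parts. Expanding this product
-- gives the formula once the summation is cut down to the range where W_{i,j} can be non-zero,
-- namely i ≤ j ≤ n - r.

module Submission where

open import Defs
open import Data.Bool using (true; false; if_then_else_)
open import Data.Fin using (Fin) renaming (zero to fzero; suc to fsuc)
open import Data.Fin.Properties using () renaming (_≟_ to _≟ᶠ_)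
open import Data.List using (List; []; _∷_; _++_; map; filter; length; concat; foldr; allFin; upTo; applyUpTo; cartesianProduct)
open import Data.List.Membership.Propositional using (_∈_; _∉_; find)
open import Data.List.Membership.Propositional.Properties
open import Data.List.Membership.Propositional.Properties.WithK using (unique∧set⇒bag)
open import Data.List.Properties using (map-id; length-map; length-++; map-++; map-∘; map-upTo; map-tabulate; concat-++; filter-≐; filter-none; filter-all; length-tabulate)
open import Data.List.Relation.Binary.Disjoint.Propositional using (Disjoint)
open import Data.List.Relation.Binary.BagAndSetEquality using (∼bag⇒↭)
open import Data.List.Relation.Binary.Permutation.Propositional using (_↭_; ↭-sym; ↭⇒↭ₛ)
import Data.List.Relation.Binary.Permutation.Setoid.Properties as PermutationSetoid
open import Data.List.Relation.Binary.Subset.Propositional using (_⊆_)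
open import Data.List.Relation.Binary.Permutation.Propositional.Properties using (↭-length; Any-resp-↭; map⁺)
open import Data.List.Relation.Unary.All as All using (All; []; _∷_)
import Data.List.Relation.Unary.All.Properties as All
open import Data.List.Relation.Unary.AllPairs as AllPairs using ([]; _∷_)
import Data.List.Relation.Unary.AllPairs.Properties as AllPairs
open import Data.List.Relation.Unary.Any as Any using (here; there)
open import Data.List.Relation.Unary.Unique.Propositional using (Unique)
import Data.List.Relation.Unary.Unique.Propositional.Properties as Unique
open import Data.Nat using (ℕ; zero; suc; _+_; _*_; _∸_; _≤_; _<_; z≤n; s≤s; s≤s⁻¹; z<s; s<s; _≤?_; _<?_; _⊔_; _⊓_)
open import Data.Nat.Combinatorics using (_C_; nCk≡nC[n∸k]; k>n⇒nCk≡0; nCk+nC[k+1]≡[n+1]C[k+1])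
open import Data.Nat.ListAction using (sum)
open import Data.Nat.ListAction.Properties using (sum-++; sum-↭)
open import Data.Nat.Properties
open import Data.Product using (_×_; _,_; proj₁; proj₂)
open import Data.Sum using (_⊎_; inj₁; inj₂; [_,_])
open import Data.Unit using (⊤; tt)
open import Data.Vec using (Vec; []; _∷_; lookup; toList; tabulate; zipWith; replicate)
open import Data.Vec.Properties using (∷-injectiveʳ; lookup∘tabulate; tabulate-cong; tabulate∘lookup; lookup-zipWith; lookup-replicate)
open import Function using (_∘_; id; flip)
open import Function.Bundles using (mk⇔)
open import Relation.Nullary using (¬_; contradiction; Dec; yes; no; does; ¬?)
open import Relation.Nullary.Decidable using (dec-true; dec-false; toSum; _×-dec_; _⊎-dec_)
open import Relation.Unary using (Decidable; _≐_)
open import Relation.Binary.PropositionalEquality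
  using (_≡_; _≢_; refl; sym; trans; cong; cong₂; subst; subst₂; setoid; module ≡-Reasoning)
open import Algebra.Properties.CommutativeSemigroup +-commutativeSemigroup using () renaming (interchange to +-interchange)

private
  variable
    A B : Set

indicator : {P : Set} → Dec P → ℕ
indicator d = if does d then 1 else 0

indicator-×-dec : {P Q : Set} (p : Dec P) (q : Dec Q) → indicator (p ×-dec q) ≡ indicator p * indicator q
indicator-×-dec (yes _) (yes _) = refl
indicator-×-dec (yes _) (no _)  = refl
indicator-×-dec (no _)  _       = refl

module _ {P : A → Set} (P? : Decidable P) where

  length-filter-∷ : ∀ x xs → length (filter P? (x ∷ xs)) ≡ indicator (P? x) + length (filter P? xs)
  length-filter-∷ x xs with P? x
  ... | yes _ = refl
  ... | no _  = refl

  length-filter-++ : ∀ xs ys → length (filter P? (xs ++ ys)) ≡ length (filter P? xs) + length (filter P? ys)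
  length-filter-++ []       ys = refl
  length-filter-++ (x ∷ xs) ys with does (P? x)
  ... | true  = cong suc (length-filter-++ xs ys)
  ... | false = length-filter-++ xs ys

  length-filter-none : ∀ xs → (∀ {x} → x ∈ xs → ¬ P x) → length (filter P? xs) ≡ 0
  length-filter-none xs none = cong length (filter-none P? (All.tabulate none))

length-filter-≐ : {P Q : A → Set} (P? : Decidable P) (Q? : Decidable Q) → P ≐ Q →
                  ∀ xs → length (filter P? xs) ≡ length (filter Q? xs)
length-filter-≐ P? Q? P≐Q xs = cong length (filter-≐ P? Q? P≐Q xs)

length-filter-cartesianProduct :
  {P : A → Set} {Q : B → Set} (P? : Decidable P) (Q? : Decidable Q) → ∀ xs ys →
  length (filter (λ xy → P? (proj₁ xy) ×-dec Q? (proj₂ xy)) (cartesianProduct xs ys))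
    ≡ length (filter P? xs) * length (filter Q? ys)
length-filter-cartesianProduct P? Q? []       ys = refl
length-filter-cartesianProduct P? Q? (x ∷ xs) ys = begin
  length (filter PQ? (map (x ,_) ys ++ cartesianProduct xs ys))
    ≡⟨ length-filter-++ PQ? (map (x ,_) ys) (cartesianProduct xs ys) ⟩
  length (filter PQ? (map (x ,_) ys)) + length (filter PQ? (cartesianProduct xs ys))
    ≡⟨ cong₂ _+_ (row ys) (length-filter-cartesianProduct P? Q? xs ys) ⟩
  indicator (P? x) * #Q + length (filter P? xs) * #Q
    ≡⟨ *-distribʳ-+ #Q (indicator (P? x)) _ ⟨
  (indicator (P? x) + length (filter P? xs)) * #Q
    ≡⟨ cong (_* #Q) (length-filter-∷ P? x xs) ⟨
  length (filter P? (x ∷ xs)) * #Q ∎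
  where
  open ≡-Reasoning
  PQ? = λ xy → P? (proj₁ xy) ×-dec Q? (proj₂ xy)
  #Q = length (filter Q? ys)
  row : ∀ ys → length (filter PQ? (map (x ,_) ys)) ≡ indicator (P? x) * length (filter Q? ys)
  row []       = sym (*-zeroʳ (indicator (P? x)))
  row (y ∷ ys) = begin
    length (filter PQ? (map (x ,_) (y ∷ ys)))
      ≡⟨ length-filter-∷ PQ? (x , y) (map (x ,_) ys) ⟩
    indicator (P? x ×-dec Q? y) + length (filter PQ? (map (x ,_) ys))
      ≡⟨ cong₂ _+_ (indicator-×-dec (P? x) (Q? y)) (row ys) ⟩
    indicator (P? x) * indicator (Q? y) + indicator (P? x) * length (filter Q? ys)
      ≡⟨ *-distribˡ-+ (indicator (P? x)) (indicator (Q? y)) _ ⟨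
    indicator (P? x) * (indicator (Q? y) + length (filter Q? ys))
      ≡⟨ cong (indicator (P? x) *_) (length-filter-∷ Q? y ys) ⟨
    indicator (P? x) * length (filter Q? (y ∷ ys)) ∎

Unique-map-leftInverse : (f : A → B) (g : B → A) → ∀ {xs} → All (λ x → g (f x) ≡ x) xs →
                         Unique xs → Unique (map f xs)
Unique-map-leftInverse f g [] [] = []
Unique-map-leftInverse f g {x ∷ xs} (gfx ∷ gfxs) (x∉xs ∷ u) =
  All.map⁺ (All.zipWith distinct (x∉xs , gfxs)) ∷ Unique-map-leftInverse f g gfxs u
  where
  distinct : ∀ {y} → x ≢ y × g (f y) ≡ y → f x ≢ f y
  distinct (x≢y , gfy) fx≡fy = x≢y (trans (sym gfx) (trans (cong g fx≡fy) gfy))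

length-filter-bijection :
  {P : A → Set} {Q : B → Set} (P? : Decidable P) (Q? : Decidable Q) →
  ∀ {xs ys} → Unique xs → Unique ys → (f : A → B) (g : B → A) →
  (∀ {x} → x ∈ xs → P x → f x ∈ ys × Q (f x) × g (f x) ≡ x) →
  (∀ {y} → y ∈ ys → Q y → g y ∈ xs × P (g y) × f (g y) ≡ y) →
  length (filter P? xs) ≡ length (filter Q? ys)
length-filter-bijection P? Q? {xs} {ys} uxs uys f g fwd bwd =
  trans (sym (length-map f (filter P? xs))) (↭-length f[Pxs]↭Qys)
  where
  image⊆ : ∀ {y} → y ∈ map f (filter P? xs) → y ∈ filter Q? ys
  image⊆ y∈ with ∈-map⁻ f y∈
  ... | x , x∈ , refl with ∈-filter⁻ P? x∈
  ... | x∈xs , px with fwd x∈xs px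
  ... | fx∈ys , qfx , _ = ∈-filter⁺ Q? fx∈ys qfx
  image⊇ : ∀ {y} → y ∈ filter Q? ys → y ∈ map f (filter P? xs)
  image⊇ y∈ with ∈-filter⁻ Q? y∈
  ... | y∈ys , qy with bwd y∈ys qy
  ... | gy∈xs , pgy , fgy = subst (_∈ _) fgy (∈-map⁺ f (∈-filter⁺ P? gy∈xs pgy))
  gf≡id : All (λ x → g (f x) ≡ x) (filter P? xs)
  gf≡id = All.tabulate λ x∈ → let (x∈xs , px) = ∈-filter⁻ P? x∈ in proj₂ (proj₂ (fwd x∈xs px))
  f[Pxs]↭Qys : map f (filter P? xs) ↭ filter Q? ys
  f[Pxs]↭Qys = ∼bag⇒↭ (unique∧set⇒bag
    (Unique-map-leftInverse f g gf≡id (Unique.filter⁺ P? uxs)) (Unique.filter⁺ Q? uys)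
    (mk⇔ image⊆ image⊇))

length-filter≡length :
  {P : A → Set} (P? : Decidable P) → ∀ {xs} {ys : List B} → Unique xs → Unique ys → (f : A → B) (g : B → A) →
  (∀ {x} → x ∈ xs → P x → f x ∈ ys × g (f x) ≡ x) →
  (∀ {y} → y ∈ ys → g y ∈ xs × P (g y) × f (g y) ≡ y) →
  length (filter P? xs) ≡ length ys
length-filter≡length P? {ys = ys} uxs uys f g fwd bwd = trans
  (length-filter-bijection P? (λ _ → yes tt) uxs uys f g
    (λ x∈ px → let (fx∈ , gfx≡x) = fwd x∈ px in fx∈ , tt , gfx≡x) (λ y∈ _ → bwd y∈))
  (cong length (filter-all (λ _ → yes tt) (All.universal (λ _ → tt) ys)))

Unique-++⁻ : ∀ (xs : List A) {ys} → Unique (xs ++ ys) → Unique xs × Unique ys × Disjoint xs ys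
Unique-++⁻ []       u          = [] , u , λ ()
Unique-++⁻ (x ∷ xs) (x∉ ∷ u) with Unique-++⁻ xs u
... | uxs , uys , xs#ys = All.++⁻ˡ xs x∉ ∷ uxs , uys , disjoint
  where
  disjoint : Disjoint (x ∷ xs) _
  disjoint (here refl , x∈ys) = All.lookup (All.++⁻ʳ xs x∉) x∈ys refl
  disjoint (there v∈xs , v∈ys) = xs#ys (v∈xs , v∈ys)

Unique-resp-↭ : ∀ {xs ys : List A} → xs ↭ ys → Unique xs → Unique ys
Unique-resp-↭ p = PermutationSetoid.Unique-resp-↭ (setoid _) (↭⇒↭ₛ p)

sumBelow : ℕ → (ℕ → ℕ) → ℕ
sumBelow N f = sum (applyUpTo f N)

Σ≡sumBelow : ∀ lo hi f → Σ[ lo ⋯ hi ] f ≡ sumBelow (suc hi ∸ lo) (λ i → f (lo + i))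
Σ≡sumBelow lo hi f = cong sum (map-upTo (λ i → f (lo + i)) (suc hi ∸ lo))

sumBelow-cong : ∀ N {f g} → (∀ a → a < N → f a ≡ g a) → sumBelow N f ≡ sumBelow N g
sumBelow-cong zero    f≡g = refl
sumBelow-cong (suc N) f≡g = cong₂ _+_ (f≡g 0 z<s) (sumBelow-cong N (λ a a<N → f≡g (suc a) (s<s a<N)))

sumBelow-zero : ∀ N {f} → (∀ a → a < N → f a ≡ 0) → sumBelow N f ≡ 0
sumBelow-zero N f≡0 = trans (sumBelow-cong N {g = λ _ → 0} f≡0) (sumBelow-const0 N)
  where
  sumBelow-const0 : ∀ N → sumBelow N (λ _ → 0) ≡ 0
  sumBelow-const0 zero    = refl
  sumBelow-const0 (suc N) = sumBelow-const0 N

sumBelow-+ : ∀ N f g → sumBelow N (λ a → f a + g a) ≡ sumBelow N f + sumBelow N g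
sumBelow-+ zero    f g = refl
sumBelow-+ (suc N) f g =
  trans (cong (f 0 + g 0 +_) (sumBelow-+ N (f ∘ suc) (g ∘ suc))) (+-interchange (f 0) (g 0) _ _)

sumBelow-*ˡ : ∀ N c f → sumBelow N (λ a → c * f a) ≡ c * sumBelow N f
sumBelow-*ˡ zero    c f = sym (*-zeroʳ c)
sumBelow-*ˡ (suc N) c f = trans (cong (c * f 0 +_) (sumBelow-*ˡ N c (f ∘ suc))) (sym (*-distribˡ-+ c (f 0) _))

sumBelow-split : ∀ M N f → sumBelow (M + N) f ≡ sumBelow M f + sumBelow N (λ a → f (M + a))
sumBelow-split zero    N f = refl
sumBelow-split (suc M) N f = trans (cong (f 0 +_) (sumBelow-split M N (f ∘ suc))) (sym (+-assoc (f 0) _ _))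

sumBelow-indicator : ∀ N v → v < N → sumBelow N (λ a → indicator (v ≟ a)) ≡ 1
sumBelow-indicator (suc N) zero    _         = cong suc (sumBelow-zero N (λ _ _ → refl))
sumBelow-indicator (suc N) (suc v) (s<s v<N) = sumBelow-indicator N v v<N

Σ₀-cong : ∀ N {f g} → (∀ a → a ≤ N → f a ≡ g a) → Σ[ 0 ⋯ N ] f ≡ Σ[ 0 ⋯ N ] g
Σ₀-cong N {f} {g} f≡g =
  trans (Σ≡sumBelow 0 N f) (trans (sumBelow-cong (suc N) (λ a a≤N → f≡g a (s≤s⁻¹ a≤N))) (sym (Σ≡sumBelow 0 N g)))

length-filter-fibres :
  {P : A → Set} (P? : Decidable P) (g : A → ℕ) (N : ℕ) → ∀ xs →
  (∀ {x} → x ∈ xs → P x → g x ≤ N) →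
  length (filter P? xs) ≡ Σ[ 0 ⋯ N ] (λ a → length (filter (λ x → P? x ×-dec (g x ≟ a)) xs))
length-filter-fibres P? g N [] _ =
  sym (trans (Σ≡sumBelow 0 N (λ a → length (filter (λ x → P? x ×-dec (g x ≟ a)) []))) (sumBelow-zero (suc N) λ _ _ → refl))
length-filter-fibres P? g N (x ∷ xs) g≤N = begin
  length (filter P? (x ∷ xs))
    ≡⟨ length-filter-∷ P? x xs ⟩
  indicator (P? x) + length (filter P? xs)
    ≡⟨ cong₂ _+_ indicator-as-sum (length-filter-fibres P? g N xs (g≤N ∘ there)) ⟩
  sumBelow (suc N) (λ a → indicator (P? x ×-dec (g x ≟ a))) + Σ[ 0 ⋯ N ] (fibre xs)
    ≡⟨ cong (sumBelow (suc N) (λ a → indicator (P? x ×-dec (g x ≟ a))) +_) (Σ≡sumBelow 0 N (fibre xs)) ⟩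
  sumBelow (suc N) (λ a → indicator (P? x ×-dec (g x ≟ a))) + sumBelow (suc N) (fibre xs)
    ≡⟨ sumBelow-+ (suc N) (λ a → indicator (P? x ×-dec (g x ≟ a))) (fibre xs) ⟨
  sumBelow (suc N) (λ a → indicator (P? x ×-dec (g x ≟ a)) + fibre xs a)
    ≡⟨ sumBelow-cong (suc N) (λ a _ → length-filter-∷ (λ x → P? x ×-dec (g x ≟ a)) x xs) ⟨
  sumBelow (suc N) (fibre (x ∷ xs))
    ≡⟨ Σ≡sumBelow 0 N (fibre (x ∷ xs)) ⟨
  Σ[ 0 ⋯ N ] (fibre (x ∷ xs)) ∎
  where
  open ≡-Reasoning
  fibre : List _ → ℕ → ℕ
  fibre ys a = length (filter (λ x → P? x ×-dec (g x ≟ a)) ys)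
  indicator-as-sum : indicator (P? x) ≡ sumBelow (suc N) (λ a → indicator (P? x ×-dec (g x ≟ a)))
  indicator-as-sum with P? x
  ... | yes px = sym (sumBelow-indicator (suc N) (g x) (s≤s (g≤N (here refl) px)))
  ... | no _   = sym (sumBelow-zero (suc N) λ _ _ → refl)

_∈?_ : ∀ {n} (i : Fin n) (S : List (Fin n)) → Dec (i ∈ S)
i ∈? S = Any.any? (i ≟ᶠ_) S

sign : ℕ → ℕ
sign zero    = 0
sign (suc _) = 1

nz≡sum-sign : ∀ {n} (a : Vec ℕ n) → nz a ≡ sum (map sign (toList a))
nz≡sum-sign a = go (toList a)
  where
  go : ∀ xs → length (filter (λ x → ¬? (x ≟ 0)) xs) ≡ sum (map sign xs)
  go []           = refl
  go (zero ∷ xs)  = go xs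
  go (suc _ ∷ xs) = cong suc (go xs)

nz≤ht : ∀ {n} (a : Vec ℕ n) → nz a ≤ ht a
nz≤ht a = subst (_≤ ht a) (sym (nz≡sum-sign a)) (go (toList a))
  where
  go : ∀ xs → sum (map sign xs) ≤ sum xs
  go []           = z≤n
  go (zero ∷ xs)  = go xs
  go (suc x ∷ xs) = s≤s (≤-trans (go xs) (m≤n+m _ x))

Vec-ext : ∀ {n} {x y : Vec ℕ n} → (∀ i → lookup x i ≡ lookup y i) → x ≡ y
Vec-ext {x = x} {y} x≗y = trans (sym (tabulate∘lookup x)) (trans (tabulate-cong x≗y) (tabulate∘lookup y))

toList≡map-lookup : ∀ {n} (a : Vec ℕ n) → toList a ≡ map (lookup a) (allFin n)
toList≡map-lookup []      = refl
toList≡map-lookup (x ∷ a) =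
  cong (x ∷_) (trans (toList≡map-lookup a) (trans (map-tabulate id (lookup a)) (sym (map-tabulate fsuc (lookup (x ∷ a))))))

_⊕_ : ∀ {n} → Vec ℕ n → Vec ℕ n → Vec ℕ n
_⊕_ = zipWith _+_

Apart : ∀ {n} → Vec ℕ n → Vec ℕ n → Set
Apart {n} x y = (i : Fin n) → lookup x i ≡ 0 ⊎ lookup y i ≡ 0

ht-⊕ : ∀ {n} (x y : Vec ℕ n) → ht (x ⊕ y) ≡ ht x + ht y
ht-⊕ []       []       = refl
ht-⊕ (x ∷ xs) (y ∷ ys) = trans (cong (x + y +_) (ht-⊕ xs ys)) (+-interchange x y (ht xs) (ht ys))

sign-+ : ∀ u v → u ≡ 0 ⊎ v ≡ 0 → sign (u + v) ≡ sign u + sign v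
sign-+ zero    v       _        = refl
sign-+ (suc u) zero    _        = cong sign (+-identityʳ (suc u))
sign-+ (suc u) (suc v) (inj₁ ())
sign-+ (suc u) (suc v) (inj₂ ())

nz-⊕ : ∀ {n} (x y : Vec ℕ n) → Apart x y → nz (x ⊕ y) ≡ nz x + nz y
nz-⊕ x y x⊥y = begin
  nz (x ⊕ y)                                            ≡⟨ nz≡sum-sign (x ⊕ y) ⟩
  sum (map sign (toList (x ⊕ y)))                       ≡⟨ sum-sign-⊕ x y x⊥y ⟩
  sum (map sign (toList x)) + sum (map sign (toList y)) ≡⟨ cong₂ _+_ (nz≡sum-sign x) (nz≡sum-sign y) ⟨
  nz x + nz y                                           ∎
  where
  open ≡-Reasoning
  sum-sign-⊕ : ∀ {n} (x y : Vec ℕ n) → Apart x y →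
               sum (map sign (toList (x ⊕ y))) ≡ sum (map sign (toList x)) + sum (map sign (toList y))
  sum-sign-⊕ []       []       _   = refl
  sum-sign-⊕ (x ∷ xs) (y ∷ ys) x⊥y =
    trans (cong₂ _+_ (sign-+ x y (x⊥y fzero)) (sum-sign-⊕ xs ys (x⊥y ∘ fsuc))) (+-interchange (sign x) (sign y) _ _)

-- Vectors, supports and restriction

SupportedOn : ∀ {n} → List (Fin n) → Vec ℕ n → Set
SupportedOn {n} S a = All (λ i → i ∈ S ⊎ lookup a i ≡ 0) (allFin n)

supportedOn? : ∀ {n} (S : List (Fin n)) → Decidable (SupportedOn S)
supportedOn? {n} S a = All.all? (λ i → (i ∈? S) ⊎-dec (lookup a i ≟ 0)) (allFin n)

module _ {n : ℕ} {S : List (Fin n)} (a : Vec ℕ n) where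

  SupportedOn⇒∉⇒≡0 : SupportedOn S a → ∀ {i} → i ∉ S → lookup a i ≡ 0
  SupportedOn⇒∉⇒≡0 a⊆S {i} i∉S = [ (λ i∈S → contradiction i∈S i∉S) , id ] (All.lookup a⊆S (∈-allFin i))

  ∉⇒≡0⇒SupportedOn : (∀ {i} → i ∉ S → lookup a i ≡ 0) → SupportedOn S a
  ∉⇒≡0⇒SupportedOn a≡0 = All.tabulate λ {i} _ → Data.Sum.map₂ a≡0 (toSum (i ∈? S))

restrictTo : ∀ {n} → List (Fin n) → Vec ℕ n → Vec ℕ n
restrictTo S a = tabulate (λ i → if does (i ∈? S) then lookup a i else 0)

module _ {n : ℕ} (S : List (Fin n)) (a : Vec ℕ n) where

  lookup-restrictTo-∈ : ∀ {i} → i ∈ S → lookup (restrictTo S a) i ≡ lookup a i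
  lookup-restrictTo-∈ {i} i∈S =
    trans (lookup∘tabulate _ i) (cong (if_then lookup a i else 0) (dec-true (i ∈? S) i∈S))

  lookup-restrictTo-∉ : ∀ {i} → i ∉ S → lookup (restrictTo S a) i ≡ 0
  lookup-restrictTo-∉ {i} i∉S =
    trans (lookup∘tabulate _ i) (cong (if_then lookup a i else 0) (dec-false (i ∈? S) i∉S))

  lookup-restrictTo-≤ : ∀ i → lookup (restrictTo S a) i ≤ lookup a i
  lookup-restrictTo-≤ i with i ∈? S
  ... | yes i∈S = ≤-reflexive (lookup-restrictTo-∈ i∈S)
  ... | no  i∉S = subst (_≤ lookup a i) (sym (lookup-restrictTo-∉ i∉S)) z≤n

  restrictTo-supportedOn : SupportedOn S (restrictTo S a)
  restrictTo-supportedOn = ∉⇒≡0⇒SupportedOn (restrictTo S a) lookup-restrictTo-∉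

lookup-⊕ : ∀ {n} (x y : Vec ℕ n) i → lookup (x ⊕ y) i ≡ lookup x i + lookup y i
lookup-⊕ x y i = lookup-zipWith _+_ i x y

module _ {n : ℕ} {S T : List (Fin n)} (S#T : Disjoint S T) (x y : Vec ℕ n)
         (x⊆S : SupportedOn S x) (y⊆T : SupportedOn T y) where

  supportedOn-apart : Apart x y
  supportedOn-apart i with i ∈? S
  ... | yes i∈S = inj₂ (SupportedOn⇒∉⇒≡0 y y⊆T (λ i∈T → S#T (i∈S , i∈T)))
  ... | no  i∉S = inj₁ (SupportedOn⇒∉⇒≡0 x x⊆S i∉S)

  ⊕-supportedOn-++ : SupportedOn (S ++ T) (x ⊕ y)
  ⊕-supportedOn-++ = ∉⇒≡0⇒SupportedOn (x ⊕ y) λ {i} i∉S++T → trans (lookup-⊕ x y i)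
    (cong₂ _+_ (SupportedOn⇒∉⇒≡0 x x⊆S (i∉S++T ∘ ∈-++⁺ˡ)) (SupportedOn⇒∉⇒≡0 y y⊆T (i∉S++T ∘ ∈-++⁺ʳ S)))

  restrictTo-⊕ˡ : restrictTo S (x ⊕ y) ≡ x
  restrictTo-⊕ˡ = Vec-ext component
    where
    component : ∀ i → lookup (restrictTo S (x ⊕ y)) i ≡ lookup x i
    component i with i ∈? S
    ... | yes i∈S = begin
      lookup (restrictTo S (x ⊕ y)) i ≡⟨ lookup-restrictTo-∈ S (x ⊕ y) i∈S ⟩
      lookup (x ⊕ y) i                ≡⟨ lookup-⊕ x y i ⟩
      lookup x i + lookup y i         ≡⟨ cong (lookup x i +_) (SupportedOn⇒∉⇒≡0 y y⊆T (λ i∈T → S#T (i∈S , i∈T))) ⟩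
      lookup x i + 0                  ≡⟨ +-identityʳ (lookup x i) ⟩
      lookup x i                      ∎
      where open ≡-Reasoning
    ... | no i∉S = trans (lookup-restrictTo-∉ S (x ⊕ y) i∉S) (sym (SupportedOn⇒∉⇒≡0 x x⊆S i∉S))

  restrictTo-⊕ʳ : restrictTo T (x ⊕ y) ≡ y
  restrictTo-⊕ʳ = Vec-ext component
    where
    component : ∀ i → lookup (restrictTo T (x ⊕ y)) i ≡ lookup y i
    component i with i ∈? T
    ... | yes i∈T = begin
      lookup (restrictTo T (x ⊕ y)) i ≡⟨ lookup-restrictTo-∈ T (x ⊕ y) i∈T ⟩
      lookup (x ⊕ y) i                ≡⟨ lookup-⊕ x y i ⟩
      lookup x i + lookup y i         ≡⟨ cong (_+ lookup y i) (SupportedOn⇒∉⇒≡0 x x⊆S (λ i∈S → S#T (i∈S , i∈T))) ⟩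
      lookup y i                      ∎
      where open ≡-Reasoning
    ... | no i∉T = trans (lookup-restrictTo-∉ T (x ⊕ y) i∉T) (sym (SupportedOn⇒∉⇒≡0 y y⊆T i∉T))

restrictTo-⊕-restrictTo : ∀ {n} {S T : List (Fin n)} → Disjoint S T → ∀ {a} → SupportedOn (S ++ T) a →
                          restrictTo S a ⊕ restrictTo T a ≡ a
restrictTo-⊕-restrictTo {S = S} {T} S#T {a} a⊆S++T = Vec-ext component
  where
  component : ∀ i → lookup (restrictTo S a ⊕ restrictTo T a) i ≡ lookup a i
  component i rewrite lookup-⊕ (restrictTo S a) (restrictTo T a) i with i ∈? S | i ∈? T
  ... | yes i∈S | _ = trans (cong₂ _+_ (lookup-restrictTo-∈ S a i∈S) (lookup-restrictTo-∉ T a (λ i∈T → S#T (i∈S , i∈T))))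
                            (+-identityʳ (lookup a i))
  ... | no i∉S | yes i∈T = cong₂ _+_ (lookup-restrictTo-∉ S a i∉S) (lookup-restrictTo-∈ T a i∈T)
  ... | no i∉S | no i∉T = trans (cong₂ _+_ (lookup-restrictTo-∉ S a i∉S) (lookup-restrictTo-∉ T a i∉T))
                            (sym (SupportedOn⇒∉⇒≡0 a a⊆S++T ([ i∉S , i∉T ] ∘ ∈-++⁻ S)))

sum-map-supportedOn : ∀ {n} {S : List (Fin n)} → Unique S → ∀ a → SupportedOn S a →
                      ∀ (h : ℕ → ℕ) → h 0 ≡ 0 → sum (map h (toList a)) ≡ sum (map (h ∘ lookup a) S)
sum-map-supportedOn {n} {S} uS a a⊆S h h0≡0 = begin
  sum (map h (toList a))                     ≡⟨ cong (sum ∘ map h) (toList≡map-lookup a) ⟩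
  sum (map h (map (lookup a) (allFin n)))    ≡⟨ cong sum (map-∘ (allFin n)) ⟨
  sum (map f (allFin n))                     ≡⟨ sum-↭ (map⁺ f allFin↭S++R) ⟩
  sum (map f (S ++ R))                       ≡⟨ cong sum (map-++ f S R) ⟩
  sum (map f S ++ map f R)                   ≡⟨ sum-++ (map f S) (map f R) ⟩
  sum (map f S) + sum (map f R)              ≡⟨ cong (sum (map f S) +_) (sum-outside R (All.tabulate (proj₂ ∘ ∈-filter⁻ ∉S? {xs = allFin n}))) ⟩
  sum (map f S) + 0                          ≡⟨ +-identityʳ _ ⟩
  sum (map f S)                              ∎
  where
  open ≡-Reasoning
  f = h ∘ lookup a
  ∉S? = λ i → ¬? (i ∈? S)
  R = filter ∉S? (allFin n)
  allFin↭S++R : allFin n ↭ S ++ R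
  allFin↭S++R = ∼bag⇒↭ (unique∧set⇒bag (Unique.allFin⁺ n)
    (Unique.++⁺ uS (Unique.filter⁺ ∉S? (Unique.allFin⁺ n)) (λ (i∈S , i∈R) → proj₂ (∈-filter⁻ ∉S? {xs = allFin n} i∈R) i∈S))
    (λ {i} → mk⇔ (λ _ → into i) (λ _ → ∈-allFin i)))
    where
    into : ∀ i → i ∈ S ++ R
    into i with i ∈? S
    ... | yes i∈S = ∈-++⁺ˡ i∈S
    ... | no i∉S  = ∈-++⁺ʳ S (∈-filter⁺ ∉S? (∈-allFin i) i∉S)
  sum-outside : ∀ is → All (_∉ S) is → sum (map f is) ≡ 0
  sum-outside []       []           = refl
  sum-outside (i ∷ is) (i∉S ∷ is∉S) = cong₂ _+_ (trans (cong h (SupportedOn⇒∉⇒≡0 a a⊆S i∉S)) h0≡0) (sum-outside is is∉S)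

ht-supportedOn : ∀ {n} {S : List (Fin n)} → Unique S → ∀ a → SupportedOn S a → ht a ≡ sum (map (lookup a) S)
ht-supportedOn uS a a⊆S = trans (cong sum (sym (map-id (toList a)))) (sum-map-supportedOn uS a a⊆S id refl)

nz-supportedOn : ∀ {n} {S : List (Fin n)} → Unique S → ∀ a → SupportedOn S a → nz a ≡ sum (map (sign ∘ lookup a) S)
nz-supportedOn uS a a⊆S = trans (nz≡sum-sign a) (sum-map-supportedOn uS a a⊆S sign refl)

-- Generating polynomials of finite lists

genPoly : {P : A → Set} → Decidable P → (u v : A → ℕ) → List A → Poly2
genPoly P? u v xs i j = length (filter (λ x → P? x ×-dec (u x ≟ i) ×-dec (v x ≟ j)) xs)

genPoly-cong : {P Q : A → Set} (P? : Decidable P) (Q? : Decidable Q) → P ≐ Q →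
               ∀ u v xs i j → genPoly P? u v xs i j ≡ genPoly Q? u v xs i j
genPoly-cong P? Q? (P⊆Q , Q⊆P) u v xs i j =
  length-filter-≐ _ _ (Data.Product.map₁ P⊆Q , Data.Product.map₁ Q⊆P) xs

genPoly-cartesianProduct :
  {P : A → Set} {Q : B → Set} (P? : Decidable P) (Q? : Decidable Q) (u v : A → ℕ) (u′ v′ : B → ℕ) →
  ∀ xs ys i j →
  genPoly (λ z → P? (proj₁ z) ×-dec Q? (proj₂ z)) (λ z → u (proj₁ z) + u′ (proj₂ z)) (λ z → v (proj₁ z) + v′ (proj₂ z))
          (cartesianProduct xs ys) i j
    ≡ (genPoly P? u v xs ⊛ genPoly Q? u′ v′ ys) i j
genPoly-cartesianProduct {P = P} {Q} P? Q? u v u′ v′ xs ys i j =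
  trans (length-filter-fibres Φ? (u ∘ proj₁) i xys u≤i) (Σ₀-cong i λ a a≤i →
    trans (length-filter-fibres _ (v ∘ proj₁) j xys v≤j) (Σ₀-cong j λ b b≤j →
      trans (length-filter-≐ _ _ (split , unsplit a≤i b≤j) xys)
            (length-filter-cartesianProduct _ _ xs ys)))
  where
  xys = cartesianProduct xs ys
  Φ? = λ z → (P? (proj₁ z) ×-dec Q? (proj₂ z)) ×-dec (u (proj₁ z) + u′ (proj₂ z) ≟ i) ×-dec (v (proj₁ z) + v′ (proj₂ z) ≟ j)
  Φ : _ × _ → Set
  Φ (x , y) = (P x × Q y) × u x + u′ y ≡ i × v x + v′ y ≡ j
  u≤i : ∀ {z} → z ∈ xys → Φ z → u (proj₁ z) ≤ i
  u≤i _ (_ , refl , _) = m≤m+n _ _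
  v≤j : ∀ {a z} → z ∈ xys → Φ z × u (proj₁ z) ≡ a → v (proj₁ z) ≤ j
  v≤j _ ((_ , _ , refl) , _) = m≤m+n _ _
  Ψ : ℕ → ℕ → _ × _ → Set
  Ψ a b (x , y) = (P x × u x ≡ a × v x ≡ b) × (Q y × u′ y ≡ i ∸ a × v′ y ≡ j ∸ b)
  split : ∀ {a b z} → (Φ z × u (proj₁ z) ≡ a) × v (proj₁ z) ≡ b → Ψ a b z
  split {z = x , y} ((((px , qy) , ux+u′y≡i , vx+v′y≡j) , ux≡a) , vx≡b) =
    (px , ux≡a , vx≡b) ,
    (qy , trans (sym (m+n∸m≡n (u x) (u′ y))) (cong₂ _∸_ ux+u′y≡i ux≡a) ,
          trans (sym (m+n∸m≡n (v x) (v′ y))) (cong₂ _∸_ vx+v′y≡j vx≡b))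
  unsplit : ∀ {a b} → a ≤ i → b ≤ j → ∀ {z} → Ψ a b z → (Φ z × u (proj₁ z) ≡ a) × v (proj₁ z) ≡ b
  unsplit a≤i b≤j {x , y} ((px , ux≡a , vx≡b) , (qy , u′y≡i∸a , v′y≡j∸b)) =
    (((px , qy) , trans (cong₂ _+_ ux≡a u′y≡i∸a) (m+[n∸m]≡n a≤i) ,
                  trans (cong₂ _+_ vx≡b v′y≡j∸b) (m+[n∸m]≡n b≤j)) , ux≡a) , vx≡b

⊛-cong : ∀ {F₁ F₂ G₁ G₂ : Poly2} i j → (∀ a b → b ≤ j → F₁ a b ≡ F₂ a b) → (∀ a b → b ≤ j → G₁ a b ≡ G₂ a b) →
         (F₁ ⊛ G₁) i j ≡ (F₂ ⊛ G₂) i j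
⊛-cong i j F₁≡F₂ G₁≡G₂ = Σ₀-cong i λ a _ → Σ₀-cong j λ b b≤j →
  cong₂ _*_ (F₁≡F₂ a b b≤j) (G₁≡G₂ (i ∸ a) (j ∸ b) (m∸n≤m j b))

Bounded : ∀ {m} → ℕ → Vec ℕ m → Set
Bounded {m} b a = (i : Fin m) → lookup a i ≤ b

∈-vecs⁺ : ∀ {m b} (a : Vec ℕ m) → Bounded b a → a ∈ vecs m b
∈-vecs⁺ []      _  = here refl
∈-vecs⁺ {suc m} {b} (x ∷ a) a≤b =
  ∈-concatMap⁺ (λ x → map (x ∷_) (vecs m b)) {xs = upTo (suc b)}
    (Any.map (λ { refl → ∈-map⁺ (x ∷_) (∈-vecs⁺ a (a≤b ∘ fsuc)) }) (∈-upTo⁺ (s≤s (a≤b fzero))))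

∈-vecs⁻ : ∀ {m b} (a : Vec ℕ m) → a ∈ vecs m b → Bounded b a
∈-vecs⁻ {suc m} {b} (x ∷ a) a∈ with find (∈-concatMap⁻ (λ x → map (x ∷_) (vecs m b)) {xs = upTo (suc b)} a∈)
... | y , y∈ , x∷a∈ with ∈-map⁻ (y ∷_) x∷a∈
... | _ , a∈′ , refl = λ { fzero → s≤s⁻¹ (∈-upTo⁻ y∈) ; (fsuc i) → ∈-vecs⁻ a a∈′ i }

vecs-unique : ∀ m b → Unique (vecs m b)
vecs-unique zero    b = [] ∷ []
vecs-unique (suc m) b = Unique.concat⁺
  (All.map⁺ (All.tabulate λ _ → Unique.map⁺ ∷-injectiveʳ (vecs-unique m b)))
  (AllPairs.map⁺ (AllPairs.map disjoint (Unique.upTo⁺ (suc b))))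
  where
  disjoint : ∀ {x y} → x ≢ y → Disjoint (map (x ∷_) (vecs m b)) (map (y ∷_) (vecs m b))
  disjoint x≢y (v∈ , v∈′) with ∈-map⁻ _ v∈ | ∈-map⁻ _ v∈′
  ... | _ , _ , refl | _ , _ , refl = x≢y refl

-- Enumerated in the box [0, n]ⁿ like K, so that K t is gf (inP? t) by definition.

gf : ∀ {n} {P : Vec ℕ n → Set} → Decidable P → Poly2
gf {n} P? = genPoly P? nz ht (vecs n n)

Joint : ∀ {n} (S T : List (Fin n)) (P Q : Vec ℕ n → Set) → Vec ℕ n → Set
Joint S T P Q a = P (restrictTo S a) × Q (restrictTo T a) × SupportedOn (S ++ T) a

joint? : ∀ {n} (S T : List (Fin n)) {P Q : Vec ℕ n → Set} → Decidable P → Decidable Q → Decidable (Joint S T P Q)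
joint? S T P? Q? a = P? (restrictTo S a) ×-dec Q? (restrictTo T a) ×-dec supportedOn? (S ++ T) a

module _ {n : ℕ} {S T : List (Fin n)} (S#T : Disjoint S T)
         {P Q : Vec ℕ n → Set} (P? : Decidable P) (Q? : Decidable Q)
         (P⊆S : ∀ {x} → P x → SupportedOn S x) (Q⊆T : ∀ {y} → Q y → SupportedOn T y) where

  gf-joint : ∀ i j → gf (joint? S T P? Q?) i j ≡ (gf P? ⊛ gf Q?) i j
  gf-joint i j = trans
    (length-filter-bijection _ _ (vecs-unique n n) (Unique.cartesianProduct⁺ (vecs-unique n n) (vecs-unique n n))
      split (λ (x , y) → x ⊕ y) split-correct join-correct)
    (genPoly-cartesianProduct P? Q? nz ht nz ht (vecs n n) (vecs n n) i j)
    where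
    V² = cartesianProduct (vecs n n) (vecs n n)
    Counted : Vec ℕ n → Set
    Counted a = Joint S T P Q a × nz a ≡ i × ht a ≡ j
    Counted² : Vec ℕ n × Vec ℕ n → Set
    Counted² (x , y) = (P x × Q y) × nz x + nz y ≡ i × ht x + ht y ≡ j
    split : Vec ℕ n → Vec ℕ n × Vec ℕ n
    split a = restrictTo S a , restrictTo T a
    split-correct : ∀ {a} → a ∈ vecs n n → Counted a → split a ∈ V² × Counted² (split a) × restrictTo S a ⊕ restrictTo T a ≡ a
    split-correct {a} a∈ ((px , qy , a⊆S++T) , nz≡i , ht≡j) =
      ∈-cartesianProduct⁺ (bounded S) (bounded T) ,
      ((px , qy) , trans (sym (nz-⊕ x y x⊥y)) (trans (cong nz x⊕y≡a) nz≡i) ,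
                   trans (sym (ht-⊕ x y)) (trans (cong ht x⊕y≡a) ht≡j)) ,
      x⊕y≡a
      where
      x = restrictTo S a
      y = restrictTo T a
      x⊥y : Apart x y
      x⊥y = supportedOn-apart S#T x y (restrictTo-supportedOn S a) (restrictTo-supportedOn T a)
      x⊕y≡a : x ⊕ y ≡ a
      x⊕y≡a = restrictTo-⊕-restrictTo S#T a⊆S++T
      bounded : ∀ U → restrictTo U a ∈ vecs n n
      bounded U = ∈-vecs⁺ (restrictTo U a) (λ k → ≤-trans (lookup-restrictTo-≤ U a k) (∈-vecs⁻ a a∈ k))
    join-correct : ∀ {xy} → xy ∈ V² → Counted² xy → proj₁ xy ⊕ proj₂ xy ∈ vecs n n × Counted (proj₁ xy ⊕ proj₂ xy) × split (proj₁ xy ⊕ proj₂ xy) ≡ xy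
    join-correct {x , y} xy∈ ((px , qy) , nz≡i , ht≡j) =
      ∈-vecs⁺ (x ⊕ y) bounded ,
      ((subst P (sym x≡) px , subst Q (sym y≡) qy , ⊕-supportedOn-++ S#T x y x⊆S y⊆T) ,
       trans (nz-⊕ x y x⊥y) nz≡i , trans (ht-⊕ x y) ht≡j) ,
      cong₂ _,_ x≡ y≡
      where
      x⊆S : SupportedOn S x
      x⊆S = P⊆S px
      y⊆T : SupportedOn T y
      y⊆T = Q⊆T qy
      x⊥y : Apart x y
      x⊥y = supportedOn-apart S#T x y x⊆S y⊆T
      x≡ : restrictTo S (x ⊕ y) ≡ x
      x≡ = restrictTo-⊕ˡ S#T x y x⊆S y⊆T
      y≡ : restrictTo T (x ⊕ y) ≡ y
      y≡ = restrictTo-⊕ʳ S#T x y x⊆S y⊆T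
      bounded : Bounded n (x ⊕ y)
      bounded k with x⊥y k | ∈-cartesianProduct⁻ (vecs n n) (vecs n n) xy∈
      ... | inj₁ xk≡0 | _ , y∈ = subst (_≤ n) (sym (trans (lookup-⊕ x y k) (cong (_+ lookup y k) xk≡0))) (∈-vecs⁻ y y∈ k)
      ... | inj₂ yk≡0 | x∈ , _ = subst (_≤ n) (sym (trans (lookup-⊕ x y k) (trans (cong (lookup x k +_) yk≡0) (+-identityʳ _)))) (∈-vecs⁻ x x∈ k)

-- Vectors with a prescribed support

SupportedOn-[]⇒≡zeros : ∀ {n} (a : Vec ℕ n) → SupportedOn [] a → a ≡ replicate n 0
SupportedOn-[]⇒≡zeros a a⊆[] = Vec-ext λ k → trans (SupportedOn⇒∉⇒≡0 a a⊆[] λ ()) (sym (lookup-replicate k 0))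

nz-zeros : ∀ m → nz (replicate m 0) ≡ 0
nz-zeros zero    = refl
nz-zeros (suc m) = nz-zeros m

ht-zeros : ∀ m → ht (replicate m 0) ≡ 0
ht-zeros zero    = refl
ht-zeros (suc m) = ht-zeros m

gf-supportedOn-[] : ∀ {n} i j → gf (supportedOn? {n} []) i j ≡ one i j
gf-supportedOn-[] {n} i j = trans
  (length-filter≡length _ (vecs-unique n n) (unique i j) (λ _ → tt) (λ _ → replicate n 0) fwd bwd)
  (length-witness i j)
  where
  witness : ℕ → ℕ → List ⊤
  witness zero zero = tt ∷ []
  witness _    _    = []
  unique : ∀ i j → Unique (witness i j)
  unique zero    zero    = [] ∷ []
  unique zero    (suc j) = []
  unique (suc i) j       = []
  length-witness : ∀ i j → length (witness i j) ≡ one i j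
  length-witness zero    zero    = refl
  length-witness zero    (suc j) = refl
  length-witness (suc i) j       = refl
  witness⁺ : ∀ {i j} → 0 ≡ i → 0 ≡ j → tt ∈ witness i j
  witness⁺ refl refl = here refl
  witness⁻ : ∀ {i j} → tt ∈ witness i j → 0 ≡ i × 0 ≡ j
  witness⁻ {zero} {zero} _ = refl , refl
  fwd : ∀ {a} → a ∈ vecs n n → SupportedOn [] a × nz a ≡ i × ht a ≡ j → tt ∈ witness i j × replicate n 0 ≡ a
  fwd {a} _ (a⊆[] , nz≡i , ht≡j) =
    witness⁺ (trans (sym (nz-zeros n)) (trans (cong nz (sym a≡0)) nz≡i))
             (trans (sym (ht-zeros n)) (trans (cong ht (sym a≡0)) ht≡j)) ,
    sym a≡0
    where a≡0 = SupportedOn-[]⇒≡zeros a a⊆[]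
  bwd : ∀ {u} → u ∈ witness i j →
        replicate n 0 ∈ vecs n n × (SupportedOn [] (replicate n 0) × nz (replicate n 0) ≡ i × ht (replicate n 0) ≡ j) × tt ≡ u
  bwd {tt} u∈ =
    ∈-vecs⁺ (replicate n 0) (λ k → subst (_≤ n) (sym (lookup-replicate k 0)) z≤n) ,
    (∉⇒≡0⇒SupportedOn (replicate n 0) (λ {k} _ → lookup-replicate k 0) ,
     trans (nz-zeros n) (proj₁ (witness⁻ u∈)) , trans (ht-zeros n) (proj₂ (witness⁻ u∈))) ,
    refl

[_if_] : {P : Set} → ℕ → Dec P → List ℕ
[ v if yes _ ] = v ∷ []
[ v if no _  ] = []

-- the values of the only coordinate of a vector with support {x}, nz = i, ht = j and entries ≤ n
singletonValues : ℕ → ℕ → ℕ → List ℕ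
singletonValues n zero       zero    = 0 ∷ []
singletonValues n (suc zero) (suc j) = [ suc j if suc j ≤? n ]
singletonValues n _          _       = []

∈-singletonValues⁺ : ∀ {n v} → v ≤ n → v ∈ singletonValues n (sign v) v
∈-singletonValues⁺ {v = zero}      _   = here refl
∈-singletonValues⁺ {n} {v = suc v} v≤n with suc v ≤? n
... | yes _   = here refl
... | no v≰n  = contradiction v≤n v≰n

∈-singletonValues⁻ : ∀ {n} i j {v} → v ∈ singletonValues n i j → v ≡ j × i ≡ sign j × j ≤ n
∈-singletonValues⁻     zero       zero    (here refl) = refl , refl , z≤n
∈-singletonValues⁻ {n} (suc zero) (suc j) v∈ with suc j ≤? n
∈-singletonValues⁻ {n} (suc zero) (suc j) (here refl) | yes j<n = refl , refl , j<n

singletonValues-unique : ∀ n i j → Unique (singletonValues n i j)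
singletonValues-unique n zero             zero    = [] ∷ []
singletonValues-unique n zero             (suc j) = []
singletonValues-unique n (suc zero)       zero    = []
singletonValues-unique n (suc zero)       (suc j) with suc j ≤? n
... | yes _ = [] ∷ []
... | no _  = []
singletonValues-unique n (suc (suc i))    j       = []

singleton-gf : ℕ → Poly2
singleton-gf n i j = length (singletonValues n i j)

gf-supportedOn-singleton : ∀ {n} (x : Fin n) i j → gf (supportedOn? (x ∷ [])) i j ≡ singleton-gf n i j
gf-supportedOn-singleton {n} x i j = trans
  (length-filter≡length _ (vecs-unique n n) (singletonValues-unique n i j) (λ a → lookup a x) spike fwd bwd)
  refl
  where
  spike : ℕ → Vec ℕ n
  spike v = restrictTo (x ∷ []) (replicate n v)
  lookup-spike : ∀ v → lookup (spike v) x ≡ v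
  lookup-spike v = trans (lookup-restrictTo-∈ (x ∷ []) (replicate n v) (here refl)) (lookup-replicate x v)
  spike-supportedOn : ∀ v → SupportedOn (x ∷ []) (spike v)
  spike-supportedOn v = restrictTo-supportedOn (x ∷ []) (replicate n v)
  ht≡ : ∀ a → SupportedOn (x ∷ []) a → ht a ≡ lookup a x
  ht≡ a a⊆x = trans (ht-supportedOn ([] ∷ []) a a⊆x) (+-identityʳ _)
  nz≡ : ∀ a → SupportedOn (x ∷ []) a → nz a ≡ sign (lookup a x)
  nz≡ a a⊆x = trans (nz-supportedOn ([] ∷ []) a a⊆x) (+-identityʳ _)
  fwd : ∀ {a} → a ∈ vecs n n → SupportedOn (x ∷ []) a × nz a ≡ i × ht a ≡ j →
        lookup a x ∈ singletonValues n i j × spike (lookup a x) ≡ a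
  fwd {a} a∈ (a⊆x , nz≡i , ht≡j) =
    subst₂ (λ i j → lookup a x ∈ singletonValues n i j) (trans (sym (nz≡ a a⊆x)) nz≡i) (trans (sym (ht≡ a a⊆x)) ht≡j)
      (∈-singletonValues⁺ (∈-vecs⁻ a a∈ x)) ,
    Vec-ext spike≗a
    where
    spike≗a : ∀ k → lookup (spike (lookup a x)) k ≡ lookup a k
    spike≗a k with k ∈? (x ∷ [])
    ... | yes (here refl) = lookup-spike (lookup a k)
    ... | no k∉x = trans (lookup-restrictTo-∉ (x ∷ []) (replicate n (lookup a x)) k∉x) (sym (SupportedOn⇒∉⇒≡0 a a⊆x k∉x))
  bwd : ∀ {v} → v ∈ singletonValues n i j →
        spike v ∈ vecs n n × (SupportedOn (x ∷ []) (spike v) × nz (spike v) ≡ i × ht (spike v) ≡ j) × lookup (spike v) x ≡ v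
  bwd {v} v∈ with ∈-singletonValues⁻ i j v∈
  ... | refl , refl , v≤n =
    ∈-vecs⁺ (spike v) (λ k → ≤-trans (lookup-restrictTo-≤ (x ∷ []) (replicate n v) k)
                                     (subst (_≤ n) (sym (lookup-replicate k v)) v≤n)) ,
    (spike-supportedOn v ,
     trans (nz≡ (spike v) (spike-supportedOn v)) (cong sign (lookup-spike v)) ,
     trans (ht≡ (spike v) (spike-supportedOn v)) (lookup-spike v)) ,
    lookup-spike v

-- the number of ways to write m as an ordered sum of ℓ positive parts, i.e. binom(m - 1, ℓ - 1)
compositions : ℕ → ℕ → ℕ
compositions zero    zero    = 1
compositions zero    (suc _) = 0
compositions (suc m) zero    = 0
compositions (suc m) (suc ℓ) = m C ℓ

compositions-pascal : ∀ m ℓ → compositions m ℓ + compositions m (suc ℓ) ≡ m C ℓ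
compositions-pascal zero    zero    = refl
compositions-pascal zero    (suc ℓ) = refl
compositions-pascal (suc m) zero    = refl
compositions-pascal (suc m) (suc ℓ) = nCk+nC[k+1]≡[n+1]C[k+1] m ℓ

compositions-hockeyStick : ∀ m ℓ → sumBelow m (λ b → compositions (m ∸ suc b) ℓ) ≡ compositions m (suc ℓ)
compositions-hockeyStick zero    ℓ = refl
compositions-hockeyStick (suc m) ℓ = trans (cong (compositions m ℓ +_) (compositions-hockeyStick m ℓ)) (compositions-pascal m ℓ)

-- The new coordinate is either 0 or one more part b ∈ [1, j]; the parts b sum up by the hockey-stick identity.
singleton-gf-⊛ : ∀ n r i j → j ≤ n →
  (singleton-gf n ⊛ (λ a b → (r C a) * compositions b a)) i j ≡ (suc r C i) * compositions j i
singleton-gf-⊛ n r i j j≤n = trans (Σ≡sumBelow 0 i (row i)) (rows i)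
  where
  F : Poly2
  F a b = (r C a) * compositions b a
  row : ℕ → ℕ → ℕ
  row i a = Σ[ 0 ⋯ j ] λ b → singleton-gf n a b * F (i ∸ a) (j ∸ b)
  row-0 : ∀ i → row i 0 ≡ F i j
  row-0 i = trans (Σ≡sumBelow 0 j (λ b → singleton-gf n 0 b * F i (j ∸ b)))
    (trans (cong (F i j + 0 +_) (sumBelow-zero j (λ _ _ → refl))) (trans (+-identityʳ _) (+-identityʳ _)))
  row-1 : ∀ i → row (suc i) 1 ≡ (r C i) * compositions j (suc i)
  row-1 i = begin
    row (suc i) 1                                                 ≡⟨ Σ≡sumBelow 0 j (λ b → singleton-gf n 1 b * F i (j ∸ b)) ⟩
    sumBelow j (λ b → singleton-gf n 1 (suc b) * F i (j ∸ suc b)) ≡⟨ sumBelow-cong j inside ⟩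
    sumBelow j (λ b → (r C i) * compositions (j ∸ suc b) i)       ≡⟨ sumBelow-*ˡ j (r C i) _ ⟩
    (r C i) * sumBelow j (λ b → compositions (j ∸ suc b) i)       ≡⟨ cong ((r C i) *_) (compositions-hockeyStick j i) ⟩
    (r C i) * compositions j (suc i)                              ∎
    where
    open ≡-Reasoning
    inside : ∀ b → b < j → singleton-gf n 1 (suc b) * F i (j ∸ suc b) ≡ (r C i) * compositions (j ∸ suc b) i
    inside b b<j with suc b ≤? n
    ... | yes _   = +-identityʳ _
    ... | no b≮n  = contradiction (≤-trans b<j j≤n) b≮n
  row-2+ : ∀ i a → row i (suc (suc a)) ≡ 0
  row-2+ i a = trans (Σ≡sumBelow 0 j (λ b → singleton-gf n (suc (suc a)) b * F (i ∸ suc (suc a)) (j ∸ b))) (sumBelow-zero (suc j) (λ _ _ → refl))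
  rows : ∀ i → sumBelow (suc i) (row i) ≡ (suc r C i) * compositions j i
  rows zero    = trans (cong (_+ 0) (row-0 0)) (+-identityʳ _)
  rows (suc i) = begin
    row (suc i) 0 + (row (suc i) 1 + sumBelow i (λ a → row (suc i) (suc (suc a))))
      ≡⟨ cong₂ _+_ (row-0 (suc i)) (cong₂ _+_ (row-1 i) (sumBelow-zero i (λ a _ → row-2+ (suc i) a))) ⟩
    (r C suc i) * compositions j (suc i) + ((r C i) * compositions j (suc i) + 0)
      ≡⟨ cong (F (suc i) j +_) (+-identityʳ _) ⟩
    (r C suc i) * compositions j (suc i) + (r C i) * compositions j (suc i)
      ≡⟨ *-distribʳ-+ (compositions j (suc i)) (r C suc i) (r C i) ⟨
    ((r C suc i) + (r C i)) * compositions j (suc i)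
      ≡⟨ cong (_* compositions j (suc i)) (trans (+-comm (r C suc i) (r C i)) (nCk+nC[k+1]≡[n+1]C[k+1] r i)) ⟩
    (suc r C suc i) * compositions j (suc i) ∎
    where open ≡-Reasoning

gf-supportedOn : ∀ {n} (S : List (Fin n)) → Unique S → ∀ i j → j ≤ n →
                 gf (supportedOn? S) i j ≡ (length S C i) * compositions j i
gf-supportedOn {n} []      _            i j _   = trans (gf-supportedOn-[] {n} i j) (one≡ i j)
  where
  one≡ : ∀ i j → one i j ≡ (0 C i) * compositions j i
  one≡ zero    zero    = refl
  one≡ zero    (suc j) = refl
  one≡ (suc i) j       = refl
gf-supportedOn {n} (x ∷ S) (x∉S ∷ uS) i j j≤n = begin
  gf (supportedOn? (x ∷ S)) i j
    ≡⟨ genPoly-cong (supportedOn? (x ∷ S)) (joint? (x ∷ []) S (supportedOn? (x ∷ [])) (supportedOn? S))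
                   ((λ {a} a⊆ → restrictTo-supportedOn (x ∷ []) a , restrictTo-supportedOn S a , a⊆) , proj₂ ∘ proj₂)
                   nz ht (vecs n n) i j ⟩
  gf (joint? (x ∷ []) S (supportedOn? (x ∷ [])) (supportedOn? S)) i j
    ≡⟨ gf-joint x#S (supportedOn? (x ∷ [])) (supportedOn? S) id id i j ⟩
  (gf (supportedOn? (x ∷ [])) ⊛ gf (supportedOn? S)) i j
    ≡⟨ ⊛-cong i j (λ a b _ → gf-supportedOn-singleton x a b) (λ a b b≤j → gf-supportedOn S uS a b (≤-trans b≤j j≤n)) ⟩
  (singleton-gf n ⊛ (λ a b → (length S C a) * compositions b a)) i j
    ≡⟨ singleton-gf-⊛ n (length S) i j j≤n ⟩
  (suc (length S) C i) * compositions j i ∎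
  where
  open ≡-Reasoning
  x#S : Disjoint (x ∷ []) S
  x#S (here refl , x∈S) = All.lookup x∉S x∈S refl

-- Trees and forests

Dˢ : ∀ {n} → List (Tree (Fin n)) → List (Fin n)
Dˢ []       = []
Dˢ (c ∷ cs) = D c ++ Dˢ cs

D-node : ∀ {n} (L : List (Fin n)) cs → D (node L cs) ≡ L ++ Dˢ cs
D-node L cs = cong (L ++_) (labels cs)
  where
  labels : ∀ cs → concat (map rootLabel (verticesF cs)) ≡ Dˢ cs
  labels []       = refl
  labels (c ∷ cs) = begin
    concat (map rootLabel (vertices c ++ verticesF cs))                      ≡⟨ cong concat (map-++ rootLabel (vertices c) (verticesF cs)) ⟩
    concat (map rootLabel (vertices c) ++ map rootLabel (verticesF cs))      ≡⟨ concat-++ (map rootLabel (vertices c)) _ ⟨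
    D c ++ concat (map rootLabel (verticesF cs))                             ≡⟨ cong (D c ++_) (labels cs) ⟩
    D c ++ Dˢ cs                                                             ∎
    where open ≡-Reasoning

mutual
  D-vertex-⊆ : ∀ {n} (c : Tree (Fin n)) → All (λ v → D v ⊆ D c) (vertices c)
  D-vertex-⊆ (node L cs) =
    (λ i∈ → i∈) ∷ All.map (λ v⊆ {i} i∈ → subst (i ∈_) (sym (D-node L cs)) (∈-++⁺ʳ L (v⊆ i∈))) (D-vertexF-⊆ cs)

  D-vertexF-⊆ : ∀ {n} (cs : List (Tree (Fin n))) → All (λ v → D v ⊆ Dˢ cs) (verticesF cs)
  D-vertexF-⊆ []       = []
  D-vertexF-⊆ (c ∷ cs) = All.++⁺ (All.map (λ v⊆ {i} i∈ → ∈-++⁺ˡ (v⊆ i∈)) (D-vertex-⊆ c)) (All.map (λ v⊆ {i} i∈ → ∈-++⁺ʳ (D c) (v⊆ i∈)) (D-vertexF-⊆ cs))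

Constraint : ∀ {n} → Vec ℕ n → Tree (Fin n) → Set
Constraint a v = sum (map (lookup a) (D v)) ≤ length (D v)

module _ {n : ℕ} {U : List (Fin n)} (a : Vec ℕ n) where

  sum-restrictTo : ∀ {vs} → vs ⊆ U → sum (map (lookup (restrictTo U a)) vs) ≡ sum (map (lookup a) vs)
  sum-restrictTo {[]}     _    = refl
  sum-restrictTo {i ∷ vs} vs⊆U = cong₂ _+_ (lookup-restrictTo-∈ U a (vs⊆U (here refl))) (sum-restrictTo (vs⊆U ∘ there))

  Constraints-restrictTo⁺ : ∀ {vs} → All (λ v → D v ⊆ U) vs → All (Constraint a) vs → All (Constraint (restrictTo U a)) vs
  Constraints-restrictTo⁺ []           []         = []
  Constraints-restrictTo⁺ (v⊆U ∷ vs⊆U) (ok ∷ oks) = subst (_≤ _) (sym (sum-restrictTo v⊆U)) ok ∷ Constraints-restrictTo⁺ vs⊆U oks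

  Constraints-restrictTo⁻ : ∀ {vs} → All (λ v → D v ⊆ U) vs → All (Constraint (restrictTo U a)) vs → All (Constraint a) vs
  Constraints-restrictTo⁻ []           []         = []
  Constraints-restrictTo⁻ (v⊆U ∷ vs⊆U) (ok ∷ oks) = subst (_≤ _) (sum-restrictTo v⊆U) ok ∷ Constraints-restrictTo⁻ vs⊆U oks

InForest : ∀ {n} → List (Tree (Fin n)) → Vec ℕ n → Set
InForest []       = SupportedOn []
InForest (c ∷ cs) = Joint (D c) (Dˢ cs) (InP c) (InForest cs)

inForest? : ∀ {n} (cs : List (Tree (Fin n))) → Decidable (InForest cs)
inForest? []       = supportedOn? []
inForest? (c ∷ cs) = joint? (D c) (Dˢ cs) (inP? c) (inForest? cs)

InForest⇒SupportedOn : ∀ {n} (cs : List (Tree (Fin n))) {a} → InForest cs a → SupportedOn (Dˢ cs) a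
InForest⇒SupportedOn []       a⊆[]        = a⊆[]
InForest⇒SupportedOn (c ∷ cs) (_ , _ , a⊆) = a⊆

InForest⇒Constraints : ∀ {n} (cs : List (Tree (Fin n))) a → InForest cs a → All (Constraint a) (verticesF cs)
InForest⇒Constraints []       a _                    = []
InForest⇒Constraints (c ∷ cs) a ((_ , a∈Pc) , a∈F , _) = All.++⁺
  (Constraints-restrictTo⁻ a (D-vertex-⊆ c) a∈Pc)
  (Constraints-restrictTo⁻ a (D-vertexF-⊆ cs) (InForest⇒Constraints cs (restrictTo (Dˢ cs) a) a∈F))

Constraints⇒InForest : ∀ {n} (cs : List (Tree (Fin n))) a → SupportedOn (Dˢ cs) a → All (Constraint a) (verticesF cs) →
                       InForest cs a
Constraints⇒InForest []       a a⊆ _   = a⊆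
Constraints⇒InForest (c ∷ cs) a a⊆ oks with All.++⁻ (vertices c) oks
... | oks-c , oks-cs =
  (restrictTo-supportedOn (D c) a , Constraints-restrictTo⁺ a (D-vertex-⊆ c) oks-c) ,
  Constraints⇒InForest cs (restrictTo (Dˢ cs) a) (restrictTo-supportedOn (Dˢ cs) a)
    (Constraints-restrictTo⁺ a (D-vertexF-⊆ cs) oks-cs) ,
  a⊆

-- ∏ₖ K_{t_k}; W t is Kˢ (children t) by definition.
Kˢ : ∀ {n} → List (Tree (Fin n)) → Poly2
Kˢ cs = foldr (λ c acc → K c ⊛ acc) one cs

gf-InForest : ∀ {n} (cs : List (Tree (Fin n))) → Unique (Dˢ cs) → ∀ i j → gf (inForest? cs) i j ≡ Kˢ cs i j
gf-InForest {n} []      _ i j = gf-supportedOn-[] {n} i j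
gf-InForest (c ∷ cs) u i j with Unique-++⁻ (D c) u
... | _ , uDcs , c#cs = trans
  (gf-joint c#cs (inP? c) (inForest? cs) proj₁ (InForest⇒SupportedOn cs) i j)
  (⊛-cong {F₁ = K c} i j (λ _ _ _ → refl) (λ a b _ → gf-InForest cs uDcs a b))

-- The root constraints of the trees add up.
sum-InForest≤ : ∀ {n} (cs : List (Tree (Fin n))) a → InForest cs a → sum (map (lookup a) (Dˢ cs)) ≤ length (Dˢ cs)
sum-InForest≤ []                  a _                     = z≤n
sum-InForest≤ (c@(node _ _) ∷ cs) a ((_ , root-c ∷ _) , a∈F , _) = begin
  sum (map (lookup a) (D c ++ Dˢ cs))                               ≡⟨ cong sum (map-++ (lookup a) (D c) (Dˢ cs)) ⟩
  sum (map (lookup a) (D c) ++ map (lookup a) (Dˢ cs))              ≡⟨ sum-++ (map (lookup a) (D c)) _ ⟩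
  sum (map (lookup a) (D c)) + sum (map (lookup a) (Dˢ cs))         ≡⟨ cong₂ _+_ (sum-restrictTo {U = D c} a id) (sum-restrictTo {U = Dˢ cs} a id) ⟨
  sum (map (lookup (restrictTo (D c) a)) (D c)) + sum (map (lookup (restrictTo (Dˢ cs) a)) (Dˢ cs))
                                                                    ≤⟨ +-mono-≤ root-c (sum-InForest≤ cs (restrictTo (Dˢ cs) a) a∈F) ⟩
  length (D c) + length (Dˢ cs)                                     ≡⟨ length-++ (D c) ⟨
  length (D c ++ Dˢ cs)                                             ∎
  where open ≤-Reasoning

gf-InForest-vanishes : ∀ {n} (cs : List (Tree (Fin n))) → Unique (Dˢ cs) →
                       ∀ i j → length (Dˢ cs) < j ⊎ j < i → gf (inForest? cs) i j ≡ 0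
gf-InForest-vanishes {n} cs u i j out-of-range = length-filter-none _ (vecs n n) impossible
  where
  impossible : ∀ {a} → a ∈ vecs n n → ¬ (InForest cs a × nz a ≡ i × ht a ≡ j)
  impossible {a} _ (a∈F , refl , refl) = [ flip <⇒≱ ht≤ , flip <⇒≱ (nz≤ht a) ] out-of-range
    where
    ht≤ : ht a ≤ length (Dˢ cs)
    ht≤ = subst (_≤ _) (sym (ht-supportedOn u a (InForest⇒SupportedOn cs a∈F))) (sum-InForest≤ cs a a∈F)

-- Reindexing a convolution

Σ₀-restrict : ∀ N lo hi {f g : ℕ → ℕ} → hi ≤ N →
  (∀ x → lo ≤ x → x ≤ hi → f x ≡ g x) → (∀ x → x ≤ N → x < lo ⊎ hi < x → f x ≡ 0) →
  Σ[ 0 ⋯ N ] f ≡ Σ[ lo ⋯ hi ] g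
Σ₀-restrict N lo hi {f} {g} hi≤N f≡g f≡0 = begin
  Σ[ 0 ⋯ N ] f                                                     ≡⟨ Σ≡sumBelow 0 N f ⟩
  sumBelow (suc N) f                                               ≡⟨ cong (λ l → sumBelow l f) (sym (m+[n∸m]≡n (s≤s hi≤N))) ⟩
  sumBelow (suc hi + (N ∸ hi)) f                                   ≡⟨ sumBelow-split (suc hi) (N ∸ hi) f ⟩
  sumBelow (suc hi) f + sumBelow (N ∸ hi) (λ x → f (suc hi + x))   ≡⟨ cong (sumBelow (suc hi) f +_) tail≡0 ⟩
  sumBelow (suc hi) f + 0                                          ≡⟨ +-identityʳ _ ⟩
  sumBelow (suc hi) f                                              ≡⟨ head≡ ⟩
  sumBelow (suc hi ∸ lo) (λ x → g (lo + x))                        ≡⟨ Σ≡sumBelow lo hi g ⟨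
  Σ[ lo ⋯ hi ] g                                                   ∎
  where
  open ≡-Reasoning
  tail≡0 : sumBelow (N ∸ hi) (λ x → f (suc hi + x)) ≡ 0
  tail≡0 = sumBelow-zero (N ∸ hi) λ x x<N∸hi →
    f≡0 (suc hi + x) (suc-hi+x≤N x<N∸hi) (inj₂ (s≤s (m≤m+n hi x)))
    where
    suc-hi+x≤N : ∀ {x} → x < N ∸ hi → suc hi + x ≤ N
    suc-hi+x≤N {x} x<N∸hi = subst (_≤ N) (cong suc (+-comm x hi)) (m≤o∸n⇒m+n≤o (suc x) hi≤N x<N∸hi)
  head≡ : sumBelow (suc hi) f ≡ sumBelow (suc hi ∸ lo) (λ x → g (lo + x))
  head≡ with lo ≤? suc hi
  ... | yes lo≤1+hi = begin
    sumBelow (suc hi) f                                          ≡⟨ cong (λ l → sumBelow l f) (sym (m+[n∸m]≡n lo≤1+hi)) ⟩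
    sumBelow (lo + (suc hi ∸ lo)) f                              ≡⟨ sumBelow-split lo (suc hi ∸ lo) f ⟩
    sumBelow lo f + sumBelow (suc hi ∸ lo) (λ x → f (lo + x))    ≡⟨ cong (_+ sumBelow (suc hi ∸ lo) (λ x → f (lo + x))) (sumBelow-zero lo below-lo) ⟩
    sumBelow (suc hi ∸ lo) (λ x → f (lo + x))                    ≡⟨ sumBelow-cong (suc hi ∸ lo) inside ⟩
    sumBelow (suc hi ∸ lo) (λ x → g (lo + x))                    ∎
    where
    below-lo : ∀ x → x < lo → f x ≡ 0
    below-lo x x<lo = f≡0 x (≤-trans (s≤s⁻¹ (≤-trans x<lo lo≤1+hi)) hi≤N) (inj₁ x<lo)
    inside : ∀ x → x < suc hi ∸ lo → f (lo + x) ≡ g (lo + x)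
    inside x x< = f≡g (lo + x) (m≤m+n lo x) (s≤s⁻¹ (subst (_≤ suc hi) (cong suc (+-comm x lo)) (m≤o∸n⇒m+n≤o (suc x) lo≤1+hi x<)))
  ... | no lo≰1+hi = trans
    (sumBelow-zero (suc hi) λ x x≤hi → f≡0 x (≤-trans (s≤s⁻¹ x≤hi) hi≤N) (inj₁ (<-≤-trans x≤hi (<⇒≤ (≰⇒> lo≰1+hi)))))
    (cong (λ l → sumBelow l (λ x → g (lo + x))) (sym (m≤n⇒m∸n≡0 (<⇒≤ (≰⇒> lo≰1+hi)))))

<∸⇒+< : ∀ a b c → a < b ∸ c → a + c < b
<∸⇒+< a b       zero    a<b     = subst (_< b) (sym (+-identityʳ a)) a<b
<∸⇒+< a (suc b) (suc c) a<b∸c   = subst (_< suc b) (sym (+-suc a c)) (s≤s (<∸⇒+< a b c a<b∸c))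

<∸-swap : ∀ a b c → a < c ∸ b → b < c ∸ a
<∸-swap a b c a<c∸b = m+n≤o⇒m≤o∸n (suc b) (subst (_≤ c) (cong suc (+-comm a b)) (<∸⇒+< a c b a<c∸b))

∸<⇒<∸ : ∀ {j k ℓ b} → (k + ℓ) ∸ j < b → ℓ ≤ j → b ≤ k → k ∸ b < j ∸ ℓ
∸<⇒<∸ {j} {k} {ℓ} {b} k+ℓ∸j<b ℓ≤j b≤k = +-cancelʳ-< (b + ℓ) (k ∸ b) (j ∸ ℓ) (begin-strict
  k ∸ b + (b + ℓ)  ≡⟨ +-assoc (k ∸ b) b ℓ ⟨
  k ∸ b + b + ℓ    ≡⟨ cong (_+ ℓ) (m∸n+n≡m b≤k) ⟩
  k + ℓ            <⟨ k+ℓ<j+b ⟩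
  j + b            ≡⟨ cong (_+ b) (m∸n+n≡m ℓ≤j) ⟨
  j ∸ ℓ + ℓ + b    ≡⟨ +-assoc (j ∸ ℓ) ℓ b ⟩
  j ∸ ℓ + (ℓ + b)  ≡⟨ cong (j ∸ ℓ +_) (+-comm ℓ b) ⟩
  j ∸ ℓ + (b + ℓ)  ∎)
  where
  open ≤-Reasoning
  k+ℓ<j+b : k + ℓ < j + b
  k+ℓ<j+b = ≰⇒> λ j+b≤k+ℓ → <⇒≱ k+ℓ∸j<b (m+n≤o⇒m≤o∸n b (subst (_≤ k + ℓ) (+-comm j b) j+b≤k+ℓ))

<⊔⇒ : ∀ {b x y} → b < x ⊔ y → b < x ⊎ b < y
<⊔⇒ {b} {x} {y} b<x⊔y with b <? x | b <? y
... | yes b<x | _       = inj₁ b<x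
... | no _    | yes b<y = inj₂ b<y
... | no b≮x  | no b≮y  = contradiction (⊔-lub (≮⇒≥ b≮x) (≮⇒≥ b≮y)) (<⇒≱ b<x⊔y)

⊓<⇒ : ∀ {j r ℓ} → j ⊓ r < ℓ → ℓ ≤ j → r < ℓ
⊓<⇒ {j} {r} {ℓ} j⊓r<ℓ ℓ≤j with r <? ℓ
... | yes r<ℓ = r<ℓ
... | no r≮ℓ  = contradiction (⊓-glb ℓ≤j (≮⇒≥ r≮ℓ)) (<⇒≱ j⊓r<ℓ)

compositions≡binomPred : ∀ {m ℓ} → ℓ ≤ m → compositions m ℓ ≡ binomPred m (m ∸ ℓ)
compositions≡binomPred {zero}  {zero}  _         = refl
compositions≡binomPred {suc m} {zero}  _         = sym (k>n⇒nCk≡0 (n<1+n m))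
compositions≡binomPred {suc m} {suc ℓ} (s≤s ℓ≤m) = nCk≡nC[n∸k] ℓ≤m

compositions-< : ∀ {m ℓ} → m < ℓ → compositions m ℓ ≡ 0
compositions-< {zero}  {suc ℓ} _         = refl
compositions-< {suc m} {suc ℓ} (s≤s m<ℓ) = k>n⇒nCk≡0 m<ℓ

-- Only the terms of the convolution in the ranges of the formula are non-zero.
⊛≡formula : ∀ n r m → n ≡ r + m → (Wc : Poly2) → (∀ a b → m < b ⊎ b < a → Wc a b ≡ 0) →
            ∀ j k → ((λ a b → (r C a) * compositions b a) ⊛ Wc) j k ≡ formula n r Wc j k
⊛≡formula _ r m refl Wc Wc-vanishes j k = Σ₀-restrict j ((j + r) ∸ (r + m)) (j ⊓ r) (m⊓n≤m j r) inner outer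
  where
  term : ℕ → ℕ → ℕ
  term ℓ b = (r C ℓ) * compositions b ℓ * Wc (j ∸ ℓ) (k ∸ b)
  term≡0 : ∀ ℓ b → m < k ∸ b ⊎ k ∸ b < j ∸ ℓ → term ℓ b ≡ 0
  term≡0 ℓ b out rewrite Wc-vanishes (j ∸ ℓ) (k ∸ b) out = *-zeroʳ ((r C ℓ) * compositions b ℓ)
  lo≡ : ∀ i → (i + r) ∸ (r + m) ≡ i ∸ m
  lo≡ i = trans (cong (_∸ (r + m)) (+-comm i r)) ([m+n]∸[m+o]≡n∸o r i m)

  outer : ∀ ℓ → ℓ ≤ j → ℓ < (j + r) ∸ (r + m) ⊎ j ⊓ r < ℓ → Σ[ 0 ⋯ k ] (term ℓ) ≡ 0
  outer ℓ ℓ≤j out = trans (Σ≡sumBelow 0 k (term ℓ)) (sumBelow-zero (suc k) λ b _ → term-out b out)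
    where
    term-out : ∀ b → ℓ < (j + r) ∸ (r + m) ⊎ j ⊓ r < ℓ → term ℓ b ≡ 0
    term-out b (inj₁ ℓ<lo) with m <? k ∸ b
    ... | yes m<k∸b = term≡0 ℓ b (inj₁ m<k∸b)
    ... | no  m≮k∸b = term≡0 ℓ b (inj₂ (≤-<-trans (≮⇒≥ m≮k∸b) (<∸-swap ℓ m j (subst (ℓ <_) (lo≡ j) ℓ<lo))))
    term-out b (inj₂ j⊓r<ℓ) rewrite k>n⇒nCk≡0 (⊓<⇒ j⊓r<ℓ ℓ≤j) = refl

  inner : ∀ ℓ → (j + r) ∸ (r + m) ≤ ℓ → ℓ ≤ j ⊓ r → Σ[ 0 ⋯ k ] (term ℓ) ≡
          Σ[ ℓ ⊔ ((k + r) ∸ (r + m)) ⋯ (k + ℓ) ∸ j ] λ b → (r C ℓ) * binomPred b (b ∸ ℓ) * Wc (j ∸ ℓ) (k ∸ b)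
  inner ℓ _ ℓ≤j⊓r = Σ₀-restrict k _ _ hi≤k same vanishing
    where
    ℓ≤j : ℓ ≤ j
    ℓ≤j = m≤n⊓o⇒m≤n j r ℓ≤j⊓r
    hi≤k : (k + ℓ) ∸ j ≤ k
    hi≤k = ≤-trans (∸-monoˡ-≤ j (+-monoʳ-≤ k ℓ≤j)) (≤-reflexive (m+n∸n≡m k j))
    same : ∀ b → ℓ ⊔ ((k + r) ∸ (r + m)) ≤ b → b ≤ (k + ℓ) ∸ j →
           term ℓ b ≡ (r C ℓ) * binomPred b (b ∸ ℓ) * Wc (j ∸ ℓ) (k ∸ b)
    same b lo≤b _ rewrite compositions≡binomPred (≤-trans (m≤m⊔n ℓ _) lo≤b) = refl
    vanishing : ∀ b → b ≤ k → b < ℓ ⊔ ((k + r) ∸ (r + m)) ⊎ (k + ℓ) ∸ j < b → term ℓ b ≡ 0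
    vanishing b b≤k (inj₁ b<lo) with <⊔⇒ {x = ℓ} b<lo
    ... | inj₁ b<ℓ   rewrite compositions-< b<ℓ | *-zeroʳ (r C ℓ) = refl
    ... | inj₂ b<k∸m = term≡0 ℓ b (inj₁ (<∸-swap b m k (subst (b <_) (lo≡ k) b<k∸m)))
    vanishing b b≤k (inj₂ hi<b) = term≡0 ℓ b (inj₂ (∸<⇒<∸ hi<b ℓ≤j b≤k))

module Root {n : ℕ} {R : List (Fin n)} {cs : List (Tree (Fin n))} (t-arbor : IsArbor n (node R cs)) where

  private
    t : Tree (Fin n)
    t = node R cs
    D↭ : D t ↭ allFin n
    D↭ = proj₂ t-arbor

  D-unique : Unique (D t)
  D-unique = Unique-resp-↭ (↭-sym D↭) (Unique.allFin⁺ n)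

  ∈-D : ∀ i → i ∈ D t
  ∈-D i = Any-resp-↭ (↭-sym D↭) (∈-allFin i)

  length-D : length (D t) ≡ n
  length-D = trans (↭-length D↭) (length-tabulate id)

  blocks-unique-disjoint : Unique R × Unique (Dˢ cs) × Disjoint R (Dˢ cs)
  blocks-unique-disjoint = Unique-++⁻ R (subst Unique (D-node R cs) D-unique)

  n≡r+m : n ≡ length R + length (Dˢ cs)
  n≡r+m = trans (sym length-D) (trans (cong length (D-node R cs)) (length-++ R))

  -- The root constraint is ht a ≤ n, which is automatic once ht a = k ≤ n.
  K≡gf-root⊛gf-forest : ∀ j k → k ≤ n → K t j k ≡ (gf (supportedOn? R) ⊛ gf (inForest? cs)) j k
  K≡gf-root⊛gf-forest j k k≤n = trans
    (length-filter-≐ _ _ ((λ {a} → split {a}) , (λ {a} → unsplit {a})) (vecs n n))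
    (gf-joint R#Dˢ (supportedOn? R) (inForest? cs) id (InForest⇒SupportedOn cs) j k)
    where
    R#Dˢ : Disjoint R (Dˢ cs)
    R#Dˢ = proj₂ (proj₂ blocks-unique-disjoint)
    everywhere : ∀ a → SupportedOn (D t) a
    everywhere _ = All.tabulate λ {i} _ → inj₁ (∈-D i)
    split : ∀ {a} → InP t a × nz a ≡ j × ht a ≡ k → Joint R (Dˢ cs) (SupportedOn R) (InForest cs) a × nz a ≡ j × ht a ≡ k
    split {a} ((_ , _ ∷ oks) , nz≡j , ht≡k) =
      (restrictTo-supportedOn R a ,
       Constraints⇒InForest cs (restrictTo (Dˢ cs) a) (restrictTo-supportedOn (Dˢ cs) a)
         (Constraints-restrictTo⁺ a (D-vertexF-⊆ cs) oks) ,
       subst (λ S → SupportedOn S a) (D-node R cs) (everywhere a)) ,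
      nz≡j , ht≡k
    unsplit : ∀ {a} → Joint R (Dˢ cs) (SupportedOn R) (InForest cs) a × nz a ≡ j × ht a ≡ k → InP t a × nz a ≡ j × ht a ≡ k
    unsplit {a} ((_ , a∈F , _) , nz≡j , ht≡k) =
      (everywhere a ,
       subst₂ _≤_ (ht-supportedOn D-unique a (everywhere a)) (sym length-D) (subst (_≤ n) (sym ht≡k) k≤n) ∷
       Constraints-restrictTo⁻ a (D-vertexF-⊆ cs) (InForest⇒Constraints cs (restrictTo (Dˢ cs) a) a∈F)) ,
      nz≡j , ht≡k

proposition2p8 : (n : ℕ) → 2 ≤ n → (t : Tree (Fin n)) → IsArbor n t →
    (j k : ℕ) → j ≤ k → k ≤ n →
    K t j k ≡ formula n (length (rootLabel t)) (W t) j k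
proposition2p8 n _ (node R cs) t-arbor j k _ k≤n = begin
  K (node R cs) j k
    ≡⟨ K≡gf-root⊛gf-forest j k k≤n ⟩
  (gf (supportedOn? R) ⊛ gf (inForest? cs)) j k
    ≡⟨ ⊛-cong j k (λ a b b≤k → gf-supportedOn R uR a b (≤-trans b≤k k≤n)) (λ a b _ → gf-InForest cs uF a b) ⟩
  ((λ a b → (length R C a) * compositions b a) ⊛ Kˢ cs) j k
    ≡⟨ ⊛≡formula n (length R) (length (Dˢ cs)) n≡r+m (Kˢ cs) W-vanishes j k ⟩
  formula n (length R) (Kˢ cs) j k ∎
  where
  open ≡-Reasoning
  open Root t-arbor
  uR : Unique R
  uR = proj₁ blocks-unique-disjoint
  uF : Unique (Dˢ cs)
  uF = proj₁ (proj₂ blocks-unique-disjoint)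
  W-vanishes : ∀ a b → length (Dˢ cs) < b ⊎ b < a → Kˢ cs a b ≡ 0
  W-vanishes a b out = trans (sym (gf-InForest cs uF a b)) (gf-InForest-vanishes cs uF a b out)
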